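{- Let $m\geqslant 3$ and $n\geqslant 3$ be odd integers, write $m=2m_0+1$, $n=2n_0+1$, $m_0^{+}=m_0+1$, $n_0^{+}=n_0+1$. Let $X=\{x_{i,j}\}$ be a $C_4$-face-magic projective labeling on $\mathcal{P}_{m,n}$ with $C_4$-face-magic value $S=2mn+3$. Then $X$ is bicentrally balanced, i.e. $x_{i,j}+x_{m+1-i,n+1-j}=S(i,j)$ for all vertices $(i,j)$. Furthermore $x_{m_0^{+},n_0^{+}}=\tfrac12 S(m_0^{+},n_0^{+})$; thus $x_{m_0^{+},n_0^{+}}=\tfrac14 mn+\tfrac34$ if $m_0^{+}+n_0^{+}$ is even, and $x_{m_0^{+},n_0^{+}}=\tfrac34 mn+\tfrac34$ if $m_0^{+}+n_0^{+}$ is odd.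
   Context: For integers $m,n\geqslant 2$, the $m\times n$ projective grid graph $\mathcal{P}_{m,n}$ has vertex set $\{(i,j):1\leqslant i\leqslant m,\ 1\leqslant j\leqslant n\}$ and edges: $(i,j)$–$(i,j+1)$ for $1\leqslant j\leqslant n-1$; $(i,n)$–$(m+1-i,1)$ for $1\leqslant i\leqslant m$; $(i,j)$–$(i+1,j)$ for $1\leqslant i\leqslant m-1$; $(m,j)$–$(1,n+1-j)$ for $1\leqslant j\leqslant n$. It is embedded in the projective plane in the natural way. Its 4-cycle faces are: $\{(i,j),(i+1,j),(i,j+1),(i+1,j+1)\}$ for $1\leqslant i\leqslant m-1$, $1\leqslant j\leqslant n-1$; $\{(i,n),(i+1,n),(m+1-i,1),(m-i,1)\}$ for $1\leqslant i\leqslant m-1$; $\{(m,j),(m,j+1),(1,n+1-j),(1,n-j)\}$ for $1\leqslant j\leqslant n-1$; the other two faces are digons $\{(1,1),(m,n)\}$, $\{(m,1),(1,n)\}$. A $C_4$-face-magic projective labeling is a bijection $(i,j)\mapsto x_{i,j}$ onto $\{1,\ldots,mn\}$ such that every 4-cycle face has the same label sum $S$ (the $C_4$-face-magic value). For odd $m,n$ define $S(i,j)=\tfrac12 mn+\tfrac32$ if $i+j$ is even and $S(i,j)=\tfrac32 mn+\tfrac32$ if $i+j$ is odd. A $C_4$-face-magic projective labeling with value $2mn+3$ is called bicentrally balanced if $x_{i,j}+x_{m+1-i,n+1-j}=S(i,j)$ for all vertices $(i,j)$. -}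

module Defs where

open import Data.Nat using (ℕ; _+_; _*_; _∸_; _≤_; _<_)
open import Data.Nat.DivMod using (_/_; _%_)
open import Data.Product using (_×_; ∃-syntax)
open import Relation.Binary.PropositionalEquality using (_≡_)

-- A labeling is a function x : ℕ → ℕ → ℕ, where x i j
-- stands for x_{i,j}; only its values on vertices matter.
Vertex : ℕ → ℕ → ℕ → ℕ → Set
Vertex m n i j = (1 ≤ i × i ≤ m) × (1 ≤ j × j ≤ n)

IsBijectiveLabeling : ℕ → ℕ → (ℕ → ℕ → ℕ) → Set
IsBijectiveLabeling m n x =
  (∀ i j → Vertex m n i j → 1 ≤ x i j × x i j ≤ m * n) ×
  (∀ i j k l → Vertex m n i j → Vertex m n k l → x i j ≡ x k l → (i ≡ k × j ≡ l)) ×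
  (∀ v → 1 ≤ v → v ≤ m * n → ∃[ i ] ∃[ j ] (Vertex m n i j × x i j ≡ v))

AllC4FacesSum : ℕ → ℕ → (ℕ → ℕ → ℕ) → ℕ → Set
AllC4FacesSum m n x S =
  (∀ i j → 1 ≤ i → i ≤ m ∸ 1 → 1 ≤ j → j ≤ n ∸ 1 →
     x i j + x (i + 1) j + x i (j + 1) + x (i + 1) (j + 1) ≡ S) ×
  (∀ i → 1 ≤ i → i ≤ m ∸ 1 →
     x i n + x (i + 1) n + x (m + 1 ∸ i) 1 + x (m ∸ i) 1 ≡ S) ×
  (∀ j → 1 ≤ j → j ≤ n ∸ 1 →
     x m j + x m (j + 1) + x 1 (n + 1 ∸ j) + x 1 (n ∸ j) ≡ S)

IsC4FaceMagicProjective : ℕ → ℕ → (ℕ → ℕ → ℕ) → ℕ → Set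
IsC4FaceMagicProjective m n x S = IsBijectiveLabeling m n x × AllC4FacesSum m n x S

-- S(i,j) for odd m, n:  mn/2 + 3/2  if i+j even,  3mn/2 + 3/2  if i+j odd.
-- (For odd m, n these are the exact naturals (mn+3)/2 and (3mn+3)/2.)
Sij : ℕ → ℕ → ℕ → ℕ → ℕ
Sij m n i j with (i + j) % 2
... | 0 = (m * n + 3) / 2
... | _ = (3 * m * n + 3) / 2

BicentrallyBalanced : ℕ → ℕ → (ℕ → ℕ → ℕ) → Set
BicentrallyBalanced m n x =
  ∀ i j → Vertex m n i j → x i j + x (m + 1 ∸ i) (n + 1 ∸ j) ≡ Sij m n i j

-- Write Q(i,j) = x(i,j) + x(m+1-i, n+1-j).  Stacking the faces of one column, and closing
-- the column up with a twisted face, shows that horizontally or vertically adjacent values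
-- of Q sum to S; hence Q takes one value c where i + j is even and S - c where it is odd.
-- Summing Q over the grid counts every label twice, so with mn = 2K + 1 and S = 4K + 5,
-- (2K+1)(2K+2) = c + K S, i.e. c = K + 2 = (mn + 3)/2.  The centre is its own antipode,
-- so twice its label is S(m₀+1, n₀+1).
module Submission where

open import Defs
open import Data.Bool using (if_then_else_)
open import Data.Empty using (⊥-elim)
open import Data.Fin using (Fin; toℕ; fromℕ<; opposite; punchIn)
open import Data.Fin.Permutation using (reverse)
open import Data.Fin.Properties using (toℕ<n; toℕ-fromℕ<; toℕ-injective; opposite-prop; punchInᵢ≢i)
open import Data.Nat using (ℕ; zero; suc; _+_; _*_; _∸_; _≤_; _<_; _≟_; s≤s; z≤n; parity)
open import Data.Nat.DivMod using (_/_; _%_; m*n/n≡m)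
open import Data.Nat.Properties
  using (+-0-commutativeMonoid; +-comm; +-assoc; +-identityʳ; +-suc; *-comm; *-assoc; *-identityʳ;
         *-distribʳ-+; +-cancelˡ-≡; +-cancelʳ-≡; suc-injective; +-∸-assoc; m+n∸n≡m; m∸[m∸n]≡n;
         ∸-monoˡ-≤; ∸-monoʳ-<; m<n⇒0<n∸m; m≤n+m; m≤m+n; +-monoˡ-≤; <⇒≤)
open import Data.Nat.Tactic.RingSolver using (solve-∀)
open import Algebra.Properties.CommutativeMonoid.Sum +-0-commutativeMonoid
  using (sum; sum-cong-≗; sum-remove; sum-replicate-zero; ∑-distrib-+; ∑-comm; ∑-permute)
open import Data.Parity.Base using (Parity; 0ℙ; 1ℙ; _⁻¹)
open import Data.Parity.Properties using (suc-homo-⁻¹)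
open import Data.Product using (_×_; _,_; proj₁; proj₂)
open import Relation.Binary.PropositionalEquality
open import Relation.Nullary using (does)
open import Relation.Nullary.Decidable using (dec-true; dec-false)

∑< : ℕ → (ℕ → ℕ) → ℕ
∑< n f = sum {n} (λ i → f (toℕ i))

∑<-cong : ∀ n {f g : ℕ → ℕ} → (∀ {i} → i < n → f i ≡ g i) → ∑< n f ≡ ∑< n g
∑<-cong n f≡g = sum-cong-≗ (λ i → f≡g (toℕ<n i))

∑<-zero : ∀ n {f : ℕ → ℕ} → (∀ {i} → i < n → f i ≡ 0) → ∑< n f ≡ 0
∑<-zero n f≡0 = trans (∑<-cong n f≡0) (sum-replicate-zero n)

∑<-single : ∀ n {f : ℕ → ℕ} {i} → i < n → (∀ {j} → j < n → j ≢ i → f j ≡ 0) → ∑< n f ≡ f i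
∑<-single (suc n) {f} {i} i<n f≡0 = begin
  ∑< (suc n) f                                        ≡⟨ sum-remove {i = k} (λ j → f (toℕ j)) ⟩
  f (toℕ k) + sum {n} (λ j → f (toℕ (punchIn k j)))   ≡⟨ cong₂ _+_ (cong f (toℕ-fromℕ< i<n)) rest≡0 ⟩
  f i + 0                                             ≡⟨ +-identityʳ (f i) ⟩
  f i                                                 ∎
  where
  open ≡-Reasoning
  k : Fin (suc n)
  k = fromℕ< i<n
  rest≡0 : sum {n} (λ j → f (toℕ (punchIn k j))) ≡ 0
  rest≡0 = trans (sum-cong-≗ (λ j → f≡0 (toℕ<n (punchIn k j)) (λ eq →
    punchInᵢ≢i k j (toℕ-injective (trans eq (sym (toℕ-fromℕ< i<n)))))))
    (sum-replicate-zero n)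

∑<-comm : ∀ m n (f : ℕ → ℕ → ℕ) → ∑< m (λ i → ∑< n (f i)) ≡ ∑< n (λ j → ∑< m (λ i → f i j))
∑<-comm m n f = ∑-comm {m} {n} (λ i j → f (toℕ i) (toℕ j))

∑<-+ : ∀ n (f g : ℕ → ℕ) → ∑< n (λ i → f i + g i) ≡ ∑< n f + ∑< n g
∑<-+ n f g = ∑-distrib-+ {n} (λ i → f (toℕ i)) (λ i → g (toℕ i))

∑<-const : ∀ n c → ∑< n (λ _ → c) ≡ n * c
∑<-const zero    c = refl
∑<-const (suc n) c = cong (c +_) (∑<-const n c)

suc[m∸n]≡suc[m]∸n : ∀ {m n} → n ≤ m → suc (m ∸ n) ≡ suc m ∸ n
suc[m∸n]≡suc[m]∸n n≤m = sym (+-∸-assoc 1 n≤m)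

m+1∸n≡suc[m]∸n : ∀ m n → m + 1 ∸ n ≡ suc m ∸ n
m+1∸n≡suc[m]∸n m n = cong (_∸ n) (+-comm m 1)

∑<-reverse : ∀ n (f : ℕ → ℕ) → ∑< n (λ i → f (n ∸ i)) ≡ ∑< n (λ i → f (suc i))
∑<-reverse n f = sym (trans (∑-permute {n} (λ i → f (suc (toℕ i))) reverse) (sum-cong-≗ opposite-shift))
  where
  opposite-shift : ∀ (i : Fin n) → f (suc (toℕ (opposite i))) ≡ f (n ∸ toℕ i)
  opposite-shift i = cong f (trans (cong suc (opposite-prop i)) (suc[m∸n]≡suc[m]∸n (toℕ<n i)))

∑<suc+∑<suc≡n*[1+n] : ∀ n → ∑< n suc + ∑< n suc ≡ n * suc n
∑<suc+∑<suc≡n*[1+n] zero    = refl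
∑<suc+∑<suc≡n*[1+n] (suc n) = begin
  ∑< (suc n) suc + ∑< (suc n) suc      ≡⟨ cong (λ s → s + s) split ⟩
  suc (n + T) + suc (n + T)            ≡⟨ regroup n T ⟩
  2 * suc n + (T + T)                  ≡⟨ cong (2 * suc n +_) (∑<suc+∑<suc≡n*[1+n] n) ⟩
  2 * suc n + n * suc n                ≡⟨ *-distribʳ-+ (suc n) 2 n ⟨
  suc (suc n) * suc n                  ≡⟨ *-comm (suc (suc n)) (suc n) ⟩
  suc n * suc (suc n)                  ∎
  where
  open ≡-Reasoning
  T : ℕ
  T = ∑< n suc
  split : ∑< (suc n) suc ≡ suc (n + T)
  split = cong suc (trans (∑<-+ n (λ _ → 1) suc) (cong (_+ T) (trans (∑<-const n 1) (*-identityʳ n))))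
  regroup : ∀ n T → suc (n + T) + suc (n + T) ≡ 2 * suc n + (T + T)
  regroup = solve-∀

keepIfEq : ℕ → ℕ → ℕ
keepIfEq a v = if does (a ≟ v) then v else 0

keepIfEq-refl : ∀ a → keepIfEq a a ≡ a
keepIfEq-refl a rewrite dec-true (a ≟ a) refl = refl

keepIfEq-≢ : ∀ {a v} → a ≢ v → keepIfEq a v ≡ 0
keepIfEq-≢ {a} {v} a≢v rewrite dec-false (a ≟ v) a≢v = refl

-- Double counting: each label is ∑ᵥ keepIfEq label v, and by bijectivity every v ≤ mn
-- is hit by exactly one cell.
module _ {m n : ℕ} {x : ℕ → ℕ → ℕ} (bijective : IsBijectiveLabeling m n x) where

  private
    vertex : ∀ {k l} → k < m → l < n → Vertex m n (suc k) (suc l)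
    vertex k<m l<n = (s≤s z≤n , k<m) , (s≤s z≤n , l<n)

    hit : ℕ → ℕ → ℕ → ℕ
    hit k l v = keepIfEq (x (suc k) (suc l)) (suc v)

    label≡∑hit : ∀ {k l} → k < m → l < n → x (suc k) (suc l) ≡ ∑< (m * n) (hit k l)
    label≡∑hit {k} {l} k<m l<n with x (suc k) (suc l) | proj₁ bijective (suc k) (suc l) (vertex k<m l<n)
    ... | suc a | _ , a<mn = sym (trans
      (∑<-single (m * n) a<mn (λ _ v≢a → keepIfEq-≢ (λ eq → v≢a (sym (suc-injective eq)))))
      (keepIfEq-refl (suc a)))

    ∑hit≡label : ∀ {v} → v < m * n → ∑< m (λ k → ∑< n (λ l → hit k l v)) ≡ suc v
    ∑hit≡label {v} v<mn with proj₂ (proj₂ bijective) (suc v) (s≤s z≤n) v<mn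
    ... | suc k₀ , suc l₀ , ((_ , k₀<m) , (_ , l₀<n)) , x≡v = begin
      ∑< m (λ k → ∑< n (λ l → hit k l v))
        ≡⟨ ∑<-single m k₀<m (λ k<m k≢k₀ → ∑<-zero n (λ l<n → keepIfEq-≢ (λ eq →
             k≢k₀ (suc-injective (proj₁ (same-cell k<m l<n eq)))))) ⟩
      ∑< n (λ l → hit k₀ l v)
        ≡⟨ ∑<-single n l₀<n (λ l<n l≢l₀ → keepIfEq-≢ (λ eq →
             l≢l₀ (suc-injective (proj₂ (same-cell k₀<m l<n eq))))) ⟩
      keepIfEq (x (suc k₀) (suc l₀)) (suc v)   ≡⟨ cong (λ a → keepIfEq a (suc v)) x≡v ⟩
      keepIfEq (suc v) (suc v)                 ≡⟨ keepIfEq-refl (suc v) ⟩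
      suc v                                    ∎
      where
      open ≡-Reasoning
      same-cell : ∀ {k l} → k < m → l < n → x (suc k) (suc l) ≡ suc v → suc k ≡ suc k₀ × suc l ≡ suc l₀
      same-cell k<m l<n eq =
        proj₁ (proj₂ bijective) _ _ _ _ (vertex k<m l<n) (vertex k₀<m l₀<n) (trans eq (sym x≡v))

  ∑-labels : ∑< m (λ k → ∑< n (λ l → x (suc k) (suc l))) ≡ ∑< (m * n) suc
  ∑-labels = begin
    ∑< m (λ k → ∑< n (λ l → x (suc k) (suc l)))
      ≡⟨ ∑<-cong m (λ k<m → ∑<-cong n (label≡∑hit k<m)) ⟩
    ∑< m (λ k → ∑< n (λ l → ∑< (m * n) (hit k l)))
      ≡⟨ ∑<-cong m (λ {k} _ → ∑<-comm n (m * n) (hit k)) ⟩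
    ∑< m (λ k → ∑< (m * n) (λ v → ∑< n (λ l → hit k l v)))
      ≡⟨ ∑<-comm m (m * n) (λ k v → ∑< n (λ l → hit k l v)) ⟩
    ∑< (m * n) (λ v → ∑< m (λ k → ∑< n (λ l → hit k l v)))
      ≡⟨ ∑<-cong (m * n) ∑hit≡label ⟩
    ∑< (m * n) suc ∎
    where open ≡-Reasoning

-- The value on a square of parity p of the checkerboard with value c on even squares and
-- S - c on odd ones, stated without truncated subtraction.
CheckerValue : ℕ → ℕ → Parity → ℕ → Set
CheckerValue S c 0ℙ q = q ≡ c
CheckerValue S c 1ℙ q = q + c ≡ S

checkerValue-next : ∀ {S c} p {q q′} → CheckerValue S c (p ⁻¹) q → q + q′ ≡ S → CheckerValue S c p q′
checkerValue-next 0ℙ {q} q+c≡S q+q′≡S = +-cancelˡ-≡ q _ _ (trans q+q′≡S (sym q+c≡S))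
checkerValue-next 1ℙ {q′ = q′} refl c+q′≡S = trans (+-comm q′ _) c+q′≡S

checkerValue-suc : ∀ {S c} t {q q′} → CheckerValue S c (parity t) q → q + q′ ≡ S →
                   CheckerValue S c (parity (suc t)) q′
checkerValue-suc {S} {c} t value =
  checkerValue-next (parity (suc t)) (subst (λ p → CheckerValue S c p _) (sym (suc-homo-⁻¹ t)) value)

record AdjacentSum (m n S : ℕ) (f : ℕ → ℕ → ℕ) : Set where
  field
    along-row    : ∀ {k l} → k < m → suc l < n → f k l + f k (suc l) ≡ S
    along-column : ∀ {k l} → suc k < m → l < n → f k l + f (suc k) l ≡ S

module _ {m n S : ℕ} {f : ℕ → ℕ → ℕ} (adjacent : AdjacentSum m n S f) where
  open AdjacentSum adjacent

  checkerboard : ∀ {k l} → k < m → l < n → CheckerValue S (f 0 0) (parity (k + l)) (f k l)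
  checkerboard {zero}  {zero}  _    _    = refl
  checkerboard {zero}  {suc l} 0<m  sl<n =
    checkerValue-suc l (checkerboard 0<m (<⇒≤ sl<n)) (along-row 0<m sl<n)
  checkerboard {suc k} {l}     sk<m l<n  =
    checkerValue-suc (k + l) (checkerboard (<⇒≤ sk<m) l<n) (along-column sk<m l<n)

∑<-alternating : ∀ r {S} {f : ℕ → ℕ} → (∀ {l} → suc l < 2 * r + 1 → f l + f (suc l) ≡ S) →
                 ∑< (2 * r + 1) f ≡ f 0 + r * S
∑<-alternating zero    _                 = refl
∑<-alternating (suc r) {S} {f} adjacent = begin
  ∑< (2 * suc r + 1) f
    ≡⟨ cong (λ L → ∑< L f) (odd-suc r) ⟩
  f 0 + (f 1 + ∑< (2 * r + 1) (λ l → f (2 + l)))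
    ≡⟨ cong (λ s → f 0 + (f 1 + s)) (∑<-alternating r {S} {λ l → f (2 + l)} adjacent-from-2) ⟩
  f 0 + (f 1 + (f 2 + r * S))
    ≡⟨ cong (f 0 +_) (+-assoc (f 1) (f 2) (r * S)) ⟨
  f 0 + (f 1 + f 2 + r * S)
    ≡⟨ cong (λ s → f 0 + (s + r * S)) (adjacent (shift (m≤n+m 1 (2 * r)))) ⟩
  f 0 + suc r * S ∎
  where
  open ≡-Reasoning
  odd-suc : ∀ r → 2 * suc r + 1 ≡ suc (suc (2 * r + 1))
  odd-suc = solve-∀
  shift : ∀ {l} → l < 2 * r + 1 → suc (suc l) < 2 * suc r + 1
  shift {l} l<L = subst (suc (suc l) <_) (sym (odd-suc r)) (s≤s (s≤s l<L))
  adjacent-from-2 : ∀ {l} → suc l < 2 * r + 1 → f (2 + l) + f (3 + l) ≡ S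
  adjacent-from-2 l<L = adjacent (shift l<L)

∑-adjacentSum : ∀ a b {S} {f : ℕ → ℕ → ℕ} → AdjacentSum (2 * a + 1) (2 * b + 1) S f →
                ∑< (2 * a + 1) (λ k → ∑< (2 * b + 1) (f k)) ≡ f 0 0 + (a * S + (2 * a + 1) * (b * S))
∑-adjacentSum a b {S} {f} adjacent = begin
  ∑< m (λ k → ∑< (2 * b + 1) (f k))        ≡⟨ ∑<-cong m (λ {k} k<m → ∑<-alternating b {S} {f k} (along-row k<m)) ⟩
  ∑< m (λ k → f k 0 + b * S)               ≡⟨ ∑<-+ m (λ k → f k 0) (λ _ → b * S) ⟩
  ∑< m (λ k → f k 0) + ∑< m (λ _ → b * S)  ≡⟨ cong₂ _+_ first-column (∑<-const m (b * S)) ⟩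
  f 0 0 + a * S + m * (b * S)              ≡⟨ +-assoc (f 0 0) (a * S) (m * (b * S)) ⟩
  f 0 0 + (a * S + m * (b * S))            ∎
  where
  open ≡-Reasoning
  open AdjacentSum adjacent
  m : ℕ
  m = 2 * a + 1
  first-column : ∑< m (λ k → f k 0) ≡ f 0 0 + a * S
  first-column = ∑<-alternating a {S} {λ k → f k 0} (λ sk<m → along-column sk<m (m≤n+m 1 (2 * b)))

antipodalSum : ℕ → ℕ → (ℕ → ℕ → ℕ) → ℕ → ℕ → ℕ
antipodalSum m n x i j = x i j + x (m + 1 ∸ i) (n + 1 ∸ j)

AllC4FacesSum-transpose : ∀ {m n S x} → AllC4FacesSum m n x S → AllC4FacesSum n m (λ i j → x j i) S
AllC4FacesSum-transpose {x = x} (interior , side , top) =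
  (λ i j 1≤i i≤ 1≤j j≤ → trans (swap-middle (x j i) _ _ _) (interior j i 1≤j j≤ 1≤i i≤)) , top , side
  where
  swap-middle : ∀ a b c d → a + b + c + d ≡ a + c + b + d
  swap-middle = solve-∀

module _ {m n S : ℕ} {x : ℕ → ℕ → ℕ} (faces : AllC4FacesSum m n x S) where

  private
    rowPair : ℕ → ℕ → ℕ
    rowPair i j = x i j + x i (suc j)

    interior : ∀ {i j} → 1 ≤ i → i < m → 1 ≤ j → j < n → rowPair i j + rowPair (suc i) j ≡ S
    interior {i} {j} 1≤i i<m 1≤j j<n = begin
      rowPair i j + rowPair (suc i) j
        ≡⟨ shuffle (x i j) _ _ _ ⟩
      x i j + x (suc i) j + x i (suc j) + x (suc i) (suc j)
        ≡⟨ cong₂ (λ i′ j′ → x i j + x i′ j + x i j′ + x i′ j′) (+-comm 1 i) (+-comm 1 j) ⟩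
      x i j + x (i + 1) j + x i (j + 1) + x (i + 1) (j + 1)
        ≡⟨ proj₁ faces i j 1≤i (∸-monoˡ-≤ 1 i<m) 1≤j (∸-monoˡ-≤ 1 j<n) ⟩
      S ∎
      where
      open ≡-Reasoning
      shuffle : ∀ a b c d → a + c + (b + d) ≡ a + b + c + d
      shuffle = solve-∀

    twisted : ∀ {j} → 1 ≤ j → j < n → rowPair m j + rowPair 1 (n ∸ j) ≡ S
    twisted {j} 1≤j j<n = begin
      rowPair m j + rowPair 1 (n ∸ j)
        ≡⟨ shuffle (x m j) _ _ _ ⟩
      x m j + x m (suc j) + x 1 (suc (n ∸ j)) + x 1 (n ∸ j)
        ≡⟨ cong₂ (λ j′ j″ → x m j + x m j′ + x 1 j″ + x 1 (n ∸ j)) (+-comm 1 j) n+1∸j ⟩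
      x m j + x m (j + 1) + x 1 (n + 1 ∸ j) + x 1 (n ∸ j)
        ≡⟨ proj₂ (proj₂ faces) j 1≤j (∸-monoˡ-≤ 1 j<n) ⟩
      S ∎
      where
      open ≡-Reasoning
      n+1∸j : suc (n ∸ j) ≡ n + 1 ∸ j
      n+1∸j = trans (suc[m∸n]≡suc[m]∸n (<⇒≤ j<n)) (sym (m+1∸n≡suc[m]∸n n j))
      shuffle : ∀ a b c d → a + b + (d + c) ≡ a + b + c + d
      shuffle = solve-∀

    -- Induction down the column: rowPair i j is determined by the pair above it through an
    -- interior face, and the twisted face closes the column up at i = 1.
    rowPair-antipodal : ∀ {i j} → 1 ≤ i → i ≤ m → 1 ≤ j → j < n →
                        rowPair i j + rowPair (suc m ∸ i) (n ∸ j) ≡ S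
    rowPair-antipodal {suc zero} {j} _ _ 1≤j j<n = begin
      rowPair 1 j + rowPair m (n ∸ j)
        ≡⟨ +-comm (rowPair 1 j) _ ⟩
      rowPair m (n ∸ j) + rowPair 1 j
        ≡⟨ cong (λ j′ → rowPair m (n ∸ j) + rowPair 1 j′) (m∸[m∸n]≡n (<⇒≤ j<n)) ⟨
      rowPair m (n ∸ j) + rowPair 1 (n ∸ (n ∸ j))
        ≡⟨ twisted (m<n⇒0<n∸m j<n) (∸-monoʳ-< 1≤j (<⇒≤ j<n)) ⟩
      S ∎
      where open ≡-Reasoning
    rowPair-antipodal {suc (suc k)} {j} _ 2+k≤m 1≤j j<n = begin
      rowPair (2 + k) j + rowPair (m ∸ suc k) j′
        ≡⟨ cong (_+ rowPair (m ∸ suc k) j′)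
                (next-row (rowPair-antipodal {suc k} (s≤s z≤n) (<⇒≤ 2+k≤m) 1≤j j<n)) ⟩
      rowPair (m ∸ k) j′ + rowPair (m ∸ suc k) j′
        ≡⟨ +-comm (rowPair (m ∸ k) j′) _ ⟩
      rowPair (m ∸ suc k) j′ + rowPair (m ∸ k) j′
        ≡⟨ cong (λ i′ → rowPair (m ∸ suc k) j′ + rowPair i′ j′) (suc[m∸n]≡suc[m]∸n (<⇒≤ 2+k≤m)) ⟨
      rowPair (m ∸ suc k) j′ + rowPair (suc (m ∸ suc k)) j′
        ≡⟨ interior (m<n⇒0<n∸m 2+k≤m) (∸-monoʳ-< (s≤s z≤n) (<⇒≤ 2+k≤m))
                    (m<n⇒0<n∸m j<n) (∸-monoʳ-< 1≤j (<⇒≤ j<n)) ⟩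
      S ∎
      where
      open ≡-Reasoning
      j′ : ℕ
      j′ = n ∸ j
      next-row : rowPair (suc k) j + rowPair (m ∸ k) j′ ≡ S → rowPair (2 + k) j ≡ rowPair (m ∸ k) j′
      next-row above =
        +-cancelˡ-≡ (rowPair (suc k) j) _ _ (trans (interior (s≤s z≤n) 2+k≤m 1≤j j<n) (sym above))

  antipodalSum-row : ∀ {i j} → 1 ≤ i → i ≤ m → 1 ≤ j → j < n →
                     antipodalSum m n x i j + antipodalSum m n x i (suc j) ≡ S
  antipodalSum-row {i} {j} 1≤i i≤m 1≤j j<n = begin
    x i j + x i′ (n + 1 ∸ j) + (x i (suc j) + x i′ (n + 1 ∸ suc j))
      ≡⟨ cong₂ (λ a b → x i j + x i′ a + (x i (suc j) + x i′ b)) n+1∸j (m+1∸n≡suc[m]∸n n (suc j)) ⟩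
    x i j + x i′ (suc (n ∸ j)) + (x i (suc j) + x i′ (n ∸ j))
      ≡⟨ shuffle (x i j) _ _ _ ⟩
    rowPair i j + rowPair i′ (n ∸ j)
      ≡⟨ cong (λ i″ → rowPair i j + rowPair i″ (n ∸ j)) (m+1∸n≡suc[m]∸n m i) ⟩
    rowPair i j + rowPair (suc m ∸ i) (n ∸ j)
      ≡⟨ rowPair-antipodal 1≤i i≤m 1≤j j<n ⟩
    S ∎
    where
    open ≡-Reasoning
    i′ : ℕ
    i′ = m + 1 ∸ i
    n+1∸j : n + 1 ∸ j ≡ suc (n ∸ j)
    n+1∸j = trans (m+1∸n≡suc[m]∸n n j) (sym (suc[m∸n]≡suc[m]∸n (<⇒≤ j<n)))
    shuffle : ∀ a b c d → a + b + (c + d) ≡ a + c + (d + b)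
    shuffle = solve-∀

antipodalSum-adjacent : ∀ {m n S x} → AllC4FacesSum m n x S →
                        AdjacentSum m n S (λ k l → antipodalSum m n x (suc k) (suc l))
antipodalSum-adjacent {m} {n} {S} {x} faces = record
  { along-row    = λ {k} {l} k<m sl<n →
      antipodalSum-row {m} {n} {S} {x} faces {suc k} {suc l} (s≤s z≤n) k<m (s≤s z≤n) sl<n
  ; along-column = λ {k} {l} sk<m l<n →
      antipodalSum-row {n} {m} {S} {λ i j → x j i} (AllC4FacesSum-transpose {m} {n} {S} {x} faces)
                       {suc l} {suc k} (s≤s z≤n) l<n (s≤s z≤n) sk<m
  }

∑-antipodalSum : ∀ m n (x : ℕ → ℕ → ℕ) →
  ∑< m (λ k → ∑< n (λ l → antipodalSum m n x (suc k) (suc l))) ≡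
  ∑< m (λ k → ∑< n (λ l → x (suc k) (suc l))) + ∑< m (λ k → ∑< n (λ l → x (suc k) (suc l)))
∑-antipodalSum m n x = begin
  ∑< m (λ k → ∑< n (λ l → x (suc k) (suc l) + y k l))
    ≡⟨ ∑<-cong m (λ {k} _ → ∑<-+ n (λ l → x (suc k) (suc l)) (y k)) ⟩
  ∑< m (λ k → ∑< n (λ l → x (suc k) (suc l)) + ∑< n (y k))
    ≡⟨ ∑<-+ m (λ k → ∑< n (λ l → x (suc k) (suc l))) (λ k → ∑< n (y k)) ⟩
  L + ∑< m (λ k → ∑< n (y k))
    ≡⟨ cong (L +_) (∑<-cong m (λ {k} _ → ∑<-cong n (λ {l} _ →
         cong₂ x (m+1∸n≡suc[m]∸n m (suc k)) (m+1∸n≡suc[m]∸n n (suc l))))) ⟩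
  L + ∑< m (λ k → ∑< n (λ l → x (m ∸ k) (n ∸ l)))
    ≡⟨ cong (L +_) (∑<-cong m (λ {k} _ → ∑<-reverse n (x (m ∸ k)))) ⟩
  L + ∑< m (λ k → ∑< n (λ l → x (m ∸ k) (suc l)))
    ≡⟨ cong (L +_) (∑<-reverse m (λ i → ∑< n (λ l → x i (suc l)))) ⟩
  L + L ∎
  where
  open ≡-Reasoning
  y : ℕ → ℕ → ℕ
  y k l = x (m + 1 ∸ suc k) (n + 1 ∸ suc l)
  L : ℕ
  L = ∑< m (λ k → ∑< n (λ l → x (suc k) (suc l)))

parity≡0ℙ⇒%2≡0 : ∀ p → parity p ≡ 0ℙ → p % 2 ≡ 0
parity≡0ℙ⇒%2≡0 zero          _  = refl
parity≡0ℙ⇒%2≡0 (suc (suc p)) eq = parity≡0ℙ⇒%2≡0 p eq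

parity≡1ℙ⇒%2≢0 : ∀ p → parity p ≡ 1ℙ → p % 2 ≢ 0
parity≡1ℙ⇒%2≢0 (suc zero)    _  ()
parity≡1ℙ⇒%2≢0 (suc (suc p)) eq = parity≡1ℙ⇒%2≢0 p eq

parity-suc+suc : ∀ k l → parity (suc k + suc l) ≡ parity (k + l)
parity-suc+suc k l = cong (λ t → parity (suc t)) (+-suc k l)

Sij-even : ∀ m n i j → (i + j) % 2 ≡ 0 → Sij m n i j ≡ (m * n + 3) / 2
Sij-even m n i j even with (i + j) % 2
... | zero = refl

Sij-odd : ∀ m n i j → (i + j) % 2 ≢ 0 → Sij m n i j ≡ (3 * m * n + 3) / 2
Sij-odd m n i j odd with (i + j) % 2
... | zero  = ⊥-elim (odd refl)
... | suc _ = refl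

half : ∀ {a} b → a ≡ b * 2 → a / 2 ≡ b
half b refl = m*n/n≡m b 2

centre-antipode : ∀ a → 2 * a + 1 + 1 ∸ (a + 1) ≡ a + 1
centre-antipode a = trans (cong (_∸ (a + 1)) (identity a)) (m+n∸n≡m (a + 1) (a + 1))
  where
  identity : ∀ a → 2 * a + 1 + 1 ≡ a + 1 + (a + 1)
  identity = solve-∀

centre-bounds : ∀ a → 1 ≤ a + 1 × a + 1 ≤ 2 * a + 1
centre-bounds a = m≤n+m 1 a , +-monoˡ-≤ 1 (m≤m+n a (a + 0))

*-double : ∀ y {v} → 2 * y ≡ v → 4 * y ≡ 2 * v
*-double y 2y≡v = trans (*-assoc 2 2 y) (cong (2 *_) 2y≡v)

module OddGrid (m₀ n₀ : ℕ) where

  m n K S : ℕ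
  m = 2 * m₀ + 1
  n = 2 * n₀ + 1
  K = m₀ + m * n₀
  S = 2 * m * n + 3

  mn≡2K+1 : m * n ≡ 2 * K + 1
  mn≡2K+1 = identity m₀ n₀
    where
    identity : ∀ a b → (2 * a + 1) * (2 * b + 1) ≡ 2 * (a + (2 * a + 1) * b) + 1
    identity = solve-∀

  S≡4K+5 : S ≡ 4 * K + 5
  S≡4K+5 = trans (cong (_+ 3) (trans (*-assoc 2 m n) (cong (2 *_) mn≡2K+1))) (identity K)
    where
    identity : ∀ K → 2 * (2 * K + 1) + 3 ≡ 4 * K + 5
    identity = solve-∀

  m₀S+m[n₀S]≡KS : m₀ * S + m * (n₀ * S) ≡ K * S
  m₀S+m[n₀S]≡KS = identity m₀ n₀ S
    where
    identity : ∀ a b S → a * S + (2 * a + 1) * (b * S) ≡ (a + (2 * a + 1) * b) * S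
    identity = solve-∀

  even-Sij : ∀ {i j} → (i + j) % 2 ≡ 0 → Sij m n i j ≡ K + 2
  even-Sij {i} {j} even = trans (Sij-even m n i j even) (half (K + 2) (trans (cong (_+ 3) mn≡2K+1) (identity K)))
    where
    identity : ∀ K → 2 * K + 1 + 3 ≡ (K + 2) * 2
    identity = solve-∀

  odd-Sij : ∀ {i j} → (i + j) % 2 ≢ 0 → Sij m n i j ≡ 3 * K + 3
  odd-Sij {i} {j} odd = trans (Sij-odd m n i j odd) (half (3 * K + 3) (trans 3mn+3≡6K+6 (identity K)))
    where
    3mn+3≡6K+6 : 3 * m * n + 3 ≡ 3 * (2 * K + 1) + 3
    3mn+3≡6K+6 = cong (_+ 3) (trans (*-assoc 3 m n) (cong (3 *_) mn≡2K+1))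
    identity : ∀ K → 3 * (2 * K + 1) + 3 ≡ (3 * K + 3) * 2
    identity = solve-∀

  twice-K+2 : 2 * (K + 2) ≡ m * n + 3
  twice-K+2 = trans (identity K) (cong (_+ 3) (sym mn≡2K+1))
    where
    identity : ∀ K → 2 * (K + 2) ≡ 2 * K + 1 + 3
    identity = solve-∀

  twice-3K+3 : 2 * (3 * K + 3) ≡ 3 * (m * n) + 3
  twice-3K+3 = trans (identity K) (cong (λ N → 3 * N + 3) (sym mn≡2K+1))
    where
    identity : ∀ K → 2 * (3 * K + 3) ≡ 3 * (2 * K + 1) + 3
    identity = solve-∀

  corner≡K+2 : ∀ {c} → c + K * S ≡ m * n * suc (m * n) → c ≡ K + 2
  corner≡K+2 {c} total = +-cancelʳ-≡ (K * S) c (K + 2) (begin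
    c + K * S                      ≡⟨ total ⟩
    m * n * suc (m * n)            ≡⟨ cong (λ N → N * suc N) mn≡2K+1 ⟩
    (2 * K + 1) * suc (2 * K + 1)  ≡⟨ identity K ⟩
    K + 2 + K * (4 * K + 5)        ≡⟨ cong (λ s → K + 2 + K * s) S≡4K+5 ⟨
    K + 2 + K * S                  ∎)
    where
    open ≡-Reasoning
    identity : ∀ K → (2 * K + 1) * suc (2 * K + 1) ≡ K + 2 + K * (4 * K + 5)
    identity = solve-∀

  checkerValue⇒Sij : ∀ {k l q} → CheckerValue S (K + 2) (parity (k + l)) q → q ≡ Sij m n (suc k) (suc l)
  checkerValue⇒Sij {k} {l} {q} value with parity (k + l) in eq
  ... | 0ℙ = trans value (sym (even-Sij {suc k} {suc l}
               (parity≡0ℙ⇒%2≡0 (suc k + suc l) (trans (parity-suc+suc k l) eq))))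
  ... | 1ℙ = trans (+-cancelʳ-≡ (K + 2) q (3 * K + 3) (trans value (trans S≡4K+5 (identity K))))
               (sym (odd-Sij {suc k} {suc l} (parity≡1ℙ⇒%2≢0 (suc k + suc l) (trans (parity-suc+suc k l) eq))))
    where
    identity : ∀ K → 4 * K + 5 ≡ 3 * K + 3 + (K + 2)
    identity = solve-∀

  module _ {x : ℕ → ℕ → ℕ} (bijective : IsBijectiveLabeling m n x) (faces : AllC4FacesSum m n x S) where

    private
      Q : ℕ → ℕ → ℕ
      Q k l = antipodalSum m n x (suc k) (suc l)

    antipodalSum-corner : antipodalSum m n x 1 1 ≡ K + 2
    antipodalSum-corner = corner≡K+2 (begin
      Q 0 0 + K * S                    ≡⟨ cong (Q 0 0 +_) m₀S+m[n₀S]≡KS ⟨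
      Q 0 0 + (m₀ * S + m * (n₀ * S))  ≡⟨ ∑-adjacentSum m₀ n₀ (antipodalSum-adjacent {x = x} faces) ⟨
      ∑< m (λ k → ∑< n (Q k))          ≡⟨ ∑-antipodalSum m n x ⟩
      L + L                            ≡⟨ cong (λ s → s + s) (∑-labels bijective) ⟩
      ∑< (m * n) suc + ∑< (m * n) suc  ≡⟨ ∑<suc+∑<suc≡n*[1+n] (m * n) ⟩
      m * n * suc (m * n)              ∎)
      where
      open ≡-Reasoning
      L : ℕ
      L = ∑< m (λ k → ∑< n (λ l → x (suc k) (suc l)))

    bicentrallyBalanced : BicentrallyBalanced m n x
    bicentrallyBalanced (suc k) (suc l) ((_ , k<m) , (_ , l<n)) = checkerValue⇒Sij {k} {l}
      (subst (λ c → CheckerValue S c (parity (k + l)) (Q k l)) antipodalSum-corner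
        (checkerboard (antipodalSum-adjacent {x = x} faces) k<m l<n))

  balanced⇒centre : ∀ {x} → BicentrallyBalanced m n x → 2 * x (m₀ + 1) (n₀ + 1) ≡ Sij m n (m₀ + 1) (n₀ + 1)
  balanced⇒centre {x} balanced = begin
    2 * xᶜ
      ≡⟨ cong (xᶜ +_) (+-identityʳ xᶜ) ⟩
    xᶜ + xᶜ
      ≡⟨ cong₂ (λ i j → xᶜ + x i j) (centre-antipode m₀) (centre-antipode n₀) ⟨
    xᶜ + x (m + 1 ∸ (m₀ + 1)) (n + 1 ∸ (n₀ + 1))
      ≡⟨ balanced (m₀ + 1) (n₀ + 1) (centre-bounds m₀ , centre-bounds n₀) ⟩
    Sij m n (m₀ + 1) (n₀ + 1) ∎
    where
    open ≡-Reasoning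
    xᶜ : ℕ
    xᶜ = x (m₀ + 1) (n₀ + 1)

lemma17 : (m₀ n₀ : ℕ) → 1 ≤ m₀ → 1 ≤ n₀ → (x : ℕ → ℕ → ℕ) →
    IsC4FaceMagicProjective (2 * m₀ + 1) (2 * n₀ + 1) x
      (2 * (2 * m₀ + 1) * (2 * n₀ + 1) + 3) →
    BicentrallyBalanced (2 * m₀ + 1) (2 * n₀ + 1) x
    × (2 * x (m₀ + 1) (n₀ + 1) ≡ Sij (2 * m₀ + 1) (2 * n₀ + 1) (m₀ + 1) (n₀ + 1))
    × (((m₀ + 1 + (n₀ + 1)) % 2 ≡ 0 →
          4 * x (m₀ + 1) (n₀ + 1) ≡ (2 * m₀ + 1) * (2 * n₀ + 1) + 3)
       × ((m₀ + 1 + (n₀ + 1)) % 2 ≢ 0 →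
          4 * x (m₀ + 1) (n₀ + 1) ≡ 3 * ((2 * m₀ + 1) * (2 * n₀ + 1)) + 3))
lemma17 m₀ n₀ _ _ x (bijective , faces) = balanced , centre , centre-even , centre-odd
  where
  open OddGrid m₀ n₀

  xᶜ : ℕ
  xᶜ = x (m₀ + 1) (n₀ + 1)

  balanced : BicentrallyBalanced m n x
  balanced = bicentrallyBalanced {x} bijective faces

  centre : 2 * xᶜ ≡ Sij m n (m₀ + 1) (n₀ + 1)
  centre = balanced⇒centre {x} balanced

  centre-even : (m₀ + 1 + (n₀ + 1)) % 2 ≡ 0 → 4 * xᶜ ≡ m * n + 3
  centre-even even = trans (*-double xᶜ (trans centre (even-Sij {m₀ + 1} {n₀ + 1} even))) twice-K+2

  centre-odd : (m₀ + 1 + (n₀ + 1)) % 2 ≢ 0 → 4 * xᶜ ≡ 3 * (m * n) + 3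
  centre-odd odd = trans (*-double xᶜ (trans centre (odd-Sij {m₀ + 1} {n₀ + 1} odd))) twice-3K+3
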